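{- Let $n\ge0$ be an integer and let $S_n=F_nU_n^{ -1}$, a linear operator on the space $\mathcal P_n$ of complex polynomials of degree at most $n$. Then for every $p=0,1,\dots,n$, $$S_nx^p=\frac{(n+p)!\,(n-p)!}{n!}\sum_{m=p}^{n}\binom{n}{m-p}\binom{n}{n-m}x^m .$$
   Context: The Euler polynomials $A_k(x)$ are defined by $\frac{A_k(x)}{(1-x)^{k+1}}=\sum_{m\ge0}m^kx^m$, with $A_0=1$. Linear operators on $\mathcal P_n$ are given on monomials $x^p$, $p=0,\dots,n$: $U_n x^p=\frac1{n!}(1-x)^{n-p}A_p(x)=(1-x)^{n+1}\frac1{n!}\sum_{m\ge0}m^px^m$ (invertible, with $U_n^{ -1}x^p=(x)_p[x+1]_{n-p}$, where $(\varphi)_k=\varphi(\varphi-1)\cdots(\varphi-k+1)$, $[\varphi]_k=\varphi(\varphi+1)\cdots(\varphi+k-1)$, both $=1$ for $k=0$); $F_n x^p=(1-x)^{2n+1}\sum_{m\ge0}m^p\binom{m+n}{n}x^m$ (a polynomial of degree $\le n$; $0^0=1$). -}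

module Defs where

open import Data.Nat as ℕ using (ℕ; zero; suc; _∸_)
open import Data.Nat.Properties using (_!≢0)
open import Data.Nat.DivMod using (_/_)
open import Data.Nat.Combinatorics using (_C_)
open import Data.Nat.Base using (_!)
open import Data.Integer as ℤ using (ℤ; +_; -_; _+_; _*_)
open import Data.List using (List; []; _∷_; map; foldr; upTo)

-- Polynomials with integer coefficients, as little-endian coefficient lists
-- (a₀ ∷ a₁ ∷ … represents a₀ + a₁ x + …).  Integer coefficients embed into ℂ.
Poly : Set
Poly = List ℤ

addP : Poly → Poly → Poly
addP []       q        = q
addP (a ∷ p)  []       = a ∷ p
addP (a ∷ p)  (b ∷ q)  = (a + b) ∷ addP p q

scaleP : ℤ → Poly → Poly
scaleP c = map (c *_)

mulP : Poly → Poly → Poly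
mulP []      q = []
mulP (a ∷ p) q = addP (scaleP a q) (+ 0 ∷ mulP p q)

coeff : Poly → ℕ → ℤ
coeff []      _       = + 0
coeff (a ∷ p) zero    = a
coeff (a ∷ p) (suc k) = coeff p k

monoP : ℕ → Poly
monoP zero    = + 1 ∷ []
monoP (suc m) = + 0 ∷ monoP m

sumP : List Poly → Poly
sumP = foldr addP []

prodP : List Poly → Poly
prodP = foldr mulP (+ 1 ∷ [])

Σℤ : ℕ → (ℕ → ℤ) → ℤ
Σℤ N f = foldr (λ i s → f i + s) (+ 0) (upTo N)

fallingP : ℕ → Poly
fallingP p = prodP (map (λ i → (- (+ i)) ∷ + 1 ∷ []) (upTo p))

risingP1 : ℕ → Poly
risingP1 k = prodP (map (λ i → (+ suc i) ∷ + 1 ∷ []) (upTo k))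

-- U_n^{-1} x^p = (x)_p [x+1]_{n-p}
UinvMono : ℕ → ℕ → Poly
UinvMono n p = mulP (fallingP p) (risingP1 (n ∸ p))

sgn : ℕ → ℤ
sgn zero    = + 1
sgn (suc j) = - sgn j

-- coefficient of x^k in the formal power series
--   F_n x^q = (1-x)^{2n+1} Σ_{m≥0} m^q C(m+n,n) x^m
-- i.e. Σ_{j=0}^{k} (-1)^j C(2n+1,j) (k-j)^q C(k-j+n,n)   (with 0^0 = 1).
FMonoCoeff : ℕ → ℕ → ℕ → ℤ
FMonoCoeff n q k =
  Σℤ (suc k) (λ j → sgn j * (+ (((suc (2 ℕ.* n)) C j)
                      ℕ.* ((k ∸ j) ℕ.^ q) ℕ.* ((k ∸ j ℕ.+ n) C n))))

FCoeff : ℕ → Poly → ℕ → ℤ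
FCoeff n P k = Σℤ (suc n) (λ q → coeff P q * FMonoCoeff n q k)

SMonoCoeff : ℕ → ℕ → ℕ → ℤ
SMonoCoeff n p k = FCoeff n (UinvMono n p) k

rhsP : ℕ → ℕ → Poly
rhsP n p =
  scaleP (+ (_/_ ((n ℕ.+ p) ! ℕ.* (n ∸ p) !) (n !) {{n !≢0}}))
    (sumP (map (λ m → scaleP (+ ((n C (m ∸ p)) ℕ.* (n C (n ∸ m)))) (monoP m))
               (map (p ℕ.+_) (upTo (suc (n ∸ p))))))

module Submission where

-- View a sequence f : ℕ → ℤ as the series Σ f(m) x^m: multiplication by 1 - x is
-- the backward difference ∇ and multiplication by x the shift Sh, so F_n Q has
-- coefficients ∇^{2n+1}(m ↦ Q(m) C(m+n,n)) (FCoeff-difference).  At m ∈ ℕ,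
-- U_n^{-1} x^p = (x)_p [x+1]_{n-p} equals n! · (Sh^p c_n)(m), where c_i(m) = C(m+i,i)
-- (ev-UinvMono).  The key difference identity ∇^-P says, for d ≤ j,
--     ∇^{i+j+1}(c_i · Sh^d c_j)(k) = C(i+d,k) · C(j-d,k-d)      (0 for k < d),
-- by induction on i + j: both sides obey the same Pascal-type recurrences.
-- Hence the k-th coefficient of S_n x^p is n! C(n+p,k) C(n-p,k-p), and a
-- factorial identity (coefficient-identity) matches it with the stated one.

open import Data.Nat as ℕ using (ℕ; zero; suc; _≤_; _<_; z≤n; s≤s; _∸_; _!; NonZero)
import Data.Nat.Properties as ℕP
open import Data.Nat.Combinatorics
  using (_C_; nCk+nC[k+1]≡[n+1]C[k+1]; nCn≡1; k>n⇒nCk≡0; nCk≡n!/k![n-k]!; k![n∸k]!∣n!)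
open import Data.Nat.DivMod using (_/_; m/n*n≡m; m*n/n≡m)
import Data.Nat.Tactic.RingSolver as ℕ-Solver
open import Data.Integer as ℤ using (ℤ; +_; -_; _+_; _*_; _-_)
import Data.Integer.Properties as ℤP
open import Data.Integer.Tactic.RingSolver using (solve-∀)
open import Data.List using (List; []; _∷_; map; foldr; upTo; applyUpTo; length)
open import Data.List.Properties using (length-map; length-upTo)
open import Data.Sum using (_⊎_; inj₁; inj₂)
open import Data.Product using (Σ; _,_)
open import Function using (_∘_; id)
open import Relation.Nullary using (yes; no)
open import Relation.Binary.PropositionalEquality
open ≡-Reasoning
open import Defs

∑ : ℕ → (ℕ → ℤ) → ℤ
∑ zero    f = + 0
∑ (suc N) f = f 0 + ∑ N (f ∘ suc)

∑-cong : ∀ N {f g : ℕ → ℤ} → (∀ i → i < N → f i ≡ g i) → ∑ N f ≡ ∑ N g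
∑-cong zero    h = refl
∑-cong (suc N) h = cong₂ _+_ (h 0 (s≤s z≤n)) (∑-cong N (λ i i<N → h (suc i) (s≤s i<N)))

∑-zero : ∀ N (f : ℕ → ℤ) → (∀ i → f i ≡ + 0) → ∑ N f ≡ + 0
∑-zero zero    f h = refl
∑-zero (suc N) f h rewrite h 0 | ∑-zero N (f ∘ suc) (h ∘ suc) = refl

∑-+ : ∀ N (f g : ℕ → ℤ) → ∑ N (λ i → f i + g i) ≡ ∑ N f + ∑ N g
∑-+ zero    f g = refl
∑-+ (suc N) f g rewrite ∑-+ N (f ∘ suc) (g ∘ suc) =
  interchange (f 0) (g 0) (∑ N (f ∘ suc)) (∑ N (g ∘ suc))
  where
  interchange : ∀ a b c d → a + b + (c + d) ≡ a + c + (b + d)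
  interchange = solve-∀

∑-*ˡ : ∀ N c (f : ℕ → ℤ) → ∑ N (λ i → c * f i) ≡ c * ∑ N f
∑-*ˡ zero    c f = sym (ℤP.*-zeroʳ c)
∑-*ˡ (suc N) c f rewrite ∑-*ˡ N c (f ∘ suc) = sym (ℤP.*-distribˡ-+ c (f 0) _)

∑-neg : ∀ N (f : ℕ → ℤ) → ∑ N (λ i → - f i) ≡ - ∑ N f
∑-neg zero    f = refl
∑-neg (suc N) f rewrite ∑-neg N (f ∘ suc) = sym (ℤP.neg-distrib-+ (f 0) _)

∑-swap : ∀ N M (f : ℕ → ℕ → ℤ) →
  ∑ N (λ i → ∑ M (λ j → f i j)) ≡ ∑ M (λ j → ∑ N (λ i → f i j))
∑-swap zero    M f = sym (∑-zero M _ (λ _ → refl))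
∑-swap (suc N) M f rewrite ∑-swap N M (f ∘ suc) =
  sym (∑-+ M (f 0) (λ j → ∑ N (λ i → f (suc i) j)))

-- The list-based sums of Defs are instances of ∑; Σℤ N f ≡ ∑ N f is the case g = id.
foldr-applyUpTo : ∀ N (g : ℕ → ℕ) (f : ℕ → ℤ) →
  foldr (λ i s → f i + s) (+ 0) (applyUpTo g N) ≡ ∑ N (f ∘ g)
foldr-applyUpTo zero    g f = refl
foldr-applyUpTo (suc N) g f = cong (λ s → f (g 0) + s) (foldr-applyUpTo N (g ∘ suc) f)

∏ : ℕ → (ℕ → ℤ) → ℤ
∏ zero    f = + 1
∏ (suc N) f = f 0 * ∏ N (f ∘ suc)

∏-cong : ∀ N {f g : ℕ → ℤ} → (∀ i → f i ≡ g i) → ∏ N f ≡ ∏ N g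
∏-cong zero    h = refl
∏-cong (suc N) h = cong₂ _*_ (h 0) (∏-cong N (h ∘ suc))

-- § Sequences, backward difference and shift.

-- A sequence stands for its generating series Σ f(m) x^m.
Seq : Set
Seq = ℕ → ℤ

-- Backward difference, f(-1) = 0: multiplication of the series by 1 - x.
∇ : Seq → Seq
∇ f zero    = f zero
∇ f (suc k) = f (suc k) - f k

∇^ : ℕ → Seq → Seq
∇^ zero    f = f
∇^ (suc r) f = ∇ (∇^ r f)

-- Shift: multiplication of the series by x.
Sh : Seq → Seq
Sh f zero    = + 0
Sh f (suc k) = f k

Sh^ : ℕ → Seq → Seq
Sh^ zero    f = f
Sh^ (suc d) f = Sh (Sh^ d f)

∇-cong : ∀ {f g : Seq} → f ≗ g → ∇ f ≗ ∇ g
∇-cong h zero    = h zero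
∇-cong h (suc k) = cong₂ _-_ (h (suc k)) (h k)

∇^-cong : ∀ r {f g : Seq} → f ≗ g → ∇^ r f ≗ ∇^ r g
∇^-cong zero    h = h
∇^-cong (suc r) h = ∇-cong (∇^-cong r h)

∇^-suc : ∀ r (f : Seq) → ∇^ (suc r) f ≗ ∇^ r (∇ f)
∇^-suc zero    f k = refl
∇^-suc (suc r) f k = ∇-cong (∇^-suc r f) k

∇^-+ : ∀ r (f g : Seq) → ∇^ r (λ m → f m + g m) ≗ (λ m → ∇^ r f m + ∇^ r g m)
∇^-+ zero    f g k = refl
∇^-+ (suc r) f g k = trans (∇-cong (∇^-+ r f g) k) (∇-+ (∇^ r f) (∇^ r g) k)
  where
  ∇-+ : ∀ (f g : Seq) → ∇ (λ m → f m + g m) ≗ (λ m → ∇ f m + ∇ g m)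
  ∇-+ f g zero    = refl
  ∇-+ f g (suc k) = rearrange (f (suc k)) (g (suc k)) (f k) (g k)
    where
    rearrange : ∀ a b c d → a + b - (c + d) ≡ a - c + (b - d)
    rearrange = solve-∀

∇^-* : ∀ r c (f : Seq) → ∇^ r (λ m → c * f m) ≗ (λ m → c * ∇^ r f m)
∇^-* zero    c f k = refl
∇^-* (suc r) c f k = trans (∇-cong (∇^-* r c f) k) (∇-* c (∇^ r f) k)
  where
  ∇-* : ∀ c (f : Seq) → ∇ (λ m → c * f m) ≗ (λ m → c * ∇ f m)
  ∇-* c f zero    = refl
  ∇-* c f (suc k) = factor c (f (suc k)) (f k)
    where
    factor : ∀ c a b → c * a - c * b ≡ c * (a - b)
    factor = solve-∀

∇-product : ∀ (f g : Seq) → ∇ (λ m → f m * g m) ≗ (λ m → ∇ f m * g m + Sh f m * ∇ g m)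
∇-product f g zero    = sym (ℤP.+-identityʳ _)
∇-product f g (suc k) = expand (f (suc k)) (g (suc k)) (f k) (g k)
  where
  expand : ∀ a b c d → a * b - c * d ≡ (a - c) * b + c * (b - d)
  expand = solve-∀

Sh^-cong : ∀ d {f g : Seq} → f ≗ g → Sh^ d f ≗ Sh^ d g
Sh^-cong zero    h k       = h k
Sh^-cong (suc d) h zero    = refl
Sh^-cong (suc d) h (suc k) = Sh^-cong d h k

Sh^-below : ∀ d f k → k < d → Sh^ d f k ≡ + 0
Sh^-below (suc d) f zero    _         = refl
Sh^-below (suc d) f (suc k) (s≤s k<d) = Sh^-below d f k k<d

Sh^-at : ∀ d f t → Sh^ d f (d ℕ.+ t) ≡ f t
Sh^-at zero    f t = refl
Sh^-at (suc d) f t = Sh^-at d f t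

below-or-shifted : ∀ d k → k < d ⊎ Σ ℕ (λ t → k ≡ d ℕ.+ t)
below-or-shifted zero    k       = inj₂ (k , refl)
below-or-shifted (suc d) zero    = inj₁ (s≤s z≤n)
below-or-shifted (suc d) (suc k) with below-or-shifted d k
... | inj₁ k<d       = inj₁ (s≤s k<d)
... | inj₂ (t , k≡d+t) = inj₂ (t , cong suc k≡d+t)

-- ∇ and Sh commute (the series multiplications by 1 - x and x commute).
∇^-Sh^ : ∀ r d f → ∇^ r (Sh^ d f) ≗ Sh^ d (∇^ r f)
∇^-Sh^ zero    d f k = refl
∇^-Sh^ (suc r) d f k = trans (∇-cong (∇^-Sh^ r d f) k) (∇-Sh^ d (∇^ r f) k)
  where
  ∇-Sh : ∀ f → ∇ (Sh f) ≗ Sh (∇ f)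
  ∇-Sh f zero          = refl
  ∇-Sh f (suc zero)    = ℤP.+-identityʳ (f 0)
  ∇-Sh f (suc (suc k)) = refl
  ∇-Sh^ : ∀ d f → ∇ (Sh^ d f) ≗ Sh^ d (∇ f)
  ∇-Sh^ zero    f k = refl
  ∇-Sh^ (suc d) f k = trans (∇-Sh (Sh^ d f) k) (Sh^-cong 1 (∇-Sh^ d f) k)

-- Expanding (1 - x)^r:  ∇^r f (k) = Σ_{j ≤ k} (-1)^j C(r,j) f(k - j).
∇^-expansion : ∀ r f k → ∇^ r f k ≡ ∑ (suc k) (λ j → sgn j * + (r C j) * f (k ∸ j))
∇^-expansion zero f k = sym (begin
    + 1 * + 1 * f k + ∑ k (λ j → sgn (suc j) * + 0 * f (k ∸ suc j))
      ≡⟨ cong (λ s → + 1 * + 1 * f k + s) (∑-zero k _ (λ j → vanish (sgn (suc j)) (f (k ∸ suc j)))) ⟩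
    + 1 * + 1 * f k + + 0 ≡⟨ ℤP.+-identityʳ _ ⟩
    + 1 * + 1 * f k       ≡⟨ ℤP.*-identityˡ (f k) ⟩
    f k                   ∎)
  where
  vanish : ∀ a x → a * + 0 * x ≡ + 0
  vanish a x rewrite ℤP.*-zeroʳ a = refl
∇^-expansion (suc r) f zero     = ∇^-expansion r f zero
∇^-expansion (suc r) f (suc k) = begin
  ∇^ r f (suc k) - ∇^ r f k            ≡⟨ cong₂ _-_ (∇^-expansion r f (suc k)) (∇^-expansion r f k) ⟩
  (term r (suc k) 0 + A) - B           ≡⟨ reassoc (term r (suc k) 0) A B ⟩
  term r (suc k) 0 + (A + - B)         ≡⟨ cong (λ s → term r (suc k) 0 + s) (sym merge) ⟩
  term r (suc k) 0 + ∑ (suc k) (λ j → term r (suc k) (suc j) + - term r k j)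
                                       ≡⟨ cong (λ s → term r (suc k) 0 + s) (∑-cong (suc k) (λ j _ → pascal j)) ⟩
  term r (suc k) 0 + ∑ (suc k) (λ j → term (suc r) (suc k) (suc j)) ∎
  where
  term : ℕ → ℕ → ℕ → ℤ
  term s k j = sgn j * + (s C j) * f (k ∸ j)
  A = ∑ (suc k) (λ j → term r (suc k) (suc j))
  B = ∑ (suc k) (term r k)
  reassoc : ∀ a b c → (a + b) - c ≡ a + (b + - c)
  reassoc = solve-∀
  merge : ∑ (suc k) (λ j → term r (suc k) (suc j) + - term r k j) ≡ A + - B
  merge = trans (∑-+ (suc k) (λ j → term r (suc k) (suc j)) (λ j → - term r k j))
                (cong (λ s → A + s) (∑-neg (suc k) (term r k)))
  split-coefficient : ∀ a b b' x → (- a) * (b + b') * x ≡ (- a) * b' * x + - (a * b * x)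
  split-coefficient = solve-∀
  -- Pascal's rule C(r+1,j+1) = C(r,j) + C(r,j+1) merges the two sums termwise.
  pascal : ∀ j → term r (suc k) (suc j) + - term r k j ≡ term (suc r) (suc k) (suc j)
  pascal j = sym (begin
    (- sgn j) * + (suc r C suc j) * f (k ∸ j)
      ≡⟨ cong (λ z → (- sgn j) * + z * f (k ∸ j)) (sym (nCk+nC[k+1]≡[n+1]C[k+1] r j)) ⟩
    (- sgn j) * + (r C j ℕ.+ r C suc j) * f (k ∸ j)
      ≡⟨ cong (λ z → (- sgn j) * z * f (k ∸ j)) (ℤP.pos-+ (r C j) (r C suc j)) ⟩
    (- sgn j) * (+ (r C j) + + (r C suc j)) * f (k ∸ j)
      ≡⟨ split-coefficient (sgn j) (+ (r C j)) (+ (r C suc j)) (f (k ∸ j)) ⟩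
    term r (suc k) (suc j) + - term r k j ∎)

-- c i m = C(m+i, i), the coefficients of (1 - x)^{-(i+1)}.
c : ℕ → Seq
c i m = + ((m ℕ.+ i) C i)

-- δ, the coefficients of the series 1.
δ : Seq
δ zero    = + 1
δ (suc k) = + 0

-- ∇ c_{i+1} = c_i, i.e. Pascal's rule C(k+1+i+1, i+1) - C(k+i+1, i+1) = C(k+1+i, i).
∇-c : ∀ i → ∇ (c (suc i)) ≗ c i
∇-c i zero    = cong +_ (trans (nCn≡1 (suc i)) (sym (nCn≡1 i)))
∇-c i (suc k) = begin
  + ((suc k ℕ.+ suc i) C suc i) - + ((k ℕ.+ suc i) C suc i)
    ≡⟨ cong (_- + ((k ℕ.+ suc i) C suc i)) (cong +_ (sym pascal)) ⟩
  + (M C i ℕ.+ M C suc i) - + ((k ℕ.+ suc i) C suc i)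
    ≡⟨ cong (_- + ((k ℕ.+ suc i) C suc i))
         (trans (ℤP.pos-+ (M C i) (M C suc i)) (cong (λ z → + (M C i) + + (z C suc i)) (sym (ℕP.+-suc k i)))) ⟩
  + (M C i) + + ((k ℕ.+ suc i) C suc i) - + ((k ℕ.+ suc i) C suc i)
    ≡⟨ cancel (+ (M C i)) (+ ((k ℕ.+ suc i) C suc i)) ⟩
  + (M C i) ∎
  where
  M = suc k ℕ.+ i
  pascal : M C i ℕ.+ M C suc i ≡ (suc k ℕ.+ suc i) C suc i
  pascal = trans (nCk+nC[k+1]≡[n+1]C[k+1] M i) (cong (_C suc i) (sym (ℕP.+-suc (suc k) i)))
  cancel : ∀ a b → a + b - b ≡ a
  cancel = solve-∀

-- (1 - x)^{i+1} · (1 - x)^{-(i+1)} = 1.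
∇^-c : ∀ i → ∇^ (suc i) (c i) ≗ δ
∇^-c zero    zero    = refl
∇^-c zero    (suc k) = refl
∇^-c (suc i) k = begin
  ∇^ (suc (suc i)) (c (suc i)) k ≡⟨ ∇^-suc (suc i) (c (suc i)) k ⟩
  ∇^ (suc i) (∇ (c (suc i))) k   ≡⟨ ∇^-cong (suc i) (∇-c i) k ⟩
  ∇^ (suc i) (c i) k             ≡⟨ ∇^-c i k ⟩
  δ k                            ∎

-- § The key difference identity.

-- P i j d = c_i · Sh^d c_j  and its predicted (i+j+1)-fold difference
-- T i j d k = C(i+d, k) · C(j-d, k-d)   (read as 0 for k < d).
P : ℕ → ℕ → ℕ → Seq
P i j d m = c i m * Sh^ d (c j) m

T : ℕ → ℕ → ℕ → Seq
T i j d k = + ((i ℕ.+ d) C k) * Sh^ d (λ t → + ((j ∸ d) C t)) k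

-- Base case i = 0:  Sh^d δ = T 0 j d, since C(d,k) vanishes beyond k = d.
T-base : ∀ j d k → Sh^ d δ k ≡ T 0 j d k
T-base j d k with below-or-shifted d k
... | inj₁ k<d = begin
  Sh^ d δ k          ≡⟨ Sh^-below d δ k k<d ⟩
  + 0                ≡⟨ sym (ℤP.*-zeroʳ (+ (d C k))) ⟩
  + (d C k) * + 0    ≡⟨ cong (+ (d C k) *_) (sym (Sh^-below d _ k k<d)) ⟩
  T 0 j d k          ∎
... | inj₂ (zero , refl) = begin
  Sh^ d δ (d ℕ.+ 0)                        ≡⟨ Sh^-at d δ 0 ⟩
  + 1                                      ≡⟨⟩
  + 1 * + ((j ∸ d) C 0)                    ≡⟨ cong₂ (λ a b → + a * b) (sym top) (sym (Sh^-at d _ 0)) ⟩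
  T 0 j d (d ℕ.+ 0)                        ∎
  where
  top : d C (d ℕ.+ 0) ≡ 1
  top = trans (cong (d C_) (ℕP.+-identityʳ d)) (nCn≡1 d)
... | inj₂ (suc t , refl) = begin
  Sh^ d δ (d ℕ.+ suc t)                    ≡⟨ Sh^-at d δ (suc t) ⟩
  + 0                                      ≡⟨⟩
  + 0 * + ((j ∸ d) C suc t)                ≡⟨ cong₂ (λ a b → + a * b) (sym beyond) (sym (Sh^-at d _ (suc t))) ⟩
  T 0 j d (d ℕ.+ suc t)                    ∎
  where
  beyond : d C (d ℕ.+ suc t) ≡ 0
  beyond = k>n⇒nCk≡0 (ℕP.m<m+n d (s≤s z≤n))

-- Recurrences of P, from the product rule and ∇ c_{i+1} = c_i.
P-recurrence₀ : ∀ i j → ∇ (P (suc i) (suc j) 0) ≗ (λ m → P i (suc j) 0 m + P j (suc i) 1 m)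
P-recurrence₀ i j m = begin
  ∇ (P (suc i) (suc j) 0) m
    ≡⟨ ∇-product (c (suc i)) (c (suc j)) m ⟩
  ∇ (c (suc i)) m * c (suc j) m + Sh (c (suc i)) m * ∇ (c (suc j)) m
    ≡⟨ cong₂ (λ a b → a * c (suc j) m + Sh (c (suc i)) m * b) (∇-c i m) (∇-c j m) ⟩
  c i m * c (suc j) m + Sh (c (suc i)) m * c j m
    ≡⟨ cong (λ s → c i m * c (suc j) m + s) (ℤP.*-comm (Sh (c (suc i)) m) (c j m)) ⟩
  P i (suc j) 0 m + P j (suc i) 1 m ∎

P-recurrence₁ : ∀ i j d → ∇ (P (suc i) (suc j) (suc d)) ≗ (λ m → P i (suc j) (suc d) m + Sh (P (suc i) j d) m)
P-recurrence₁ i j d m = begin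
  ∇ (P (suc i) (suc j) (suc d)) m
    ≡⟨ ∇-product (c (suc i)) (Sh^ (suc d) (c (suc j))) m ⟩
  ∇ (c (suc i)) m * S m + Sh (c (suc i)) m * ∇ (Sh^ (suc d) (c (suc j))) m
    ≡⟨ cong₂ (λ a b → a * S m + Sh (c (suc i)) m * b) (∇-c i m)
         (trans (∇^-Sh^ 1 (suc d) (c (suc j)) m) (Sh^-cong (suc d) (∇-c j) m)) ⟩
  P i (suc j) (suc d) m + Sh (c (suc i)) m * Sh^ (suc d) (c j) m
    ≡⟨ cong (λ s → P i (suc j) (suc d) m + s) (shifted-product m) ⟩
  P i (suc j) (suc d) m + Sh (P (suc i) j d) m ∎
  where
  S = Sh^ (suc d) (c (suc j))
  shifted-product : ∀ m → Sh (c (suc i)) m * Sh^ (suc d) (c j) m ≡ Sh (P (suc i) j d) m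
  shifted-product zero    = refl
  shifted-product (suc m) = refl

-- The matching recurrences of T, from Pascal's rule in the first factor.
T-recurrence₀ : ∀ i j k → T (suc i) (suc j) 0 k ≡ T i (suc j) 0 k + T j (suc i) 1 k
T-recurrence₀ i j zero    = refl
T-recurrence₀ i j (suc k) = begin
  + ((suc i ℕ.+ 0) C suc k) * X
    ≡⟨ cong (λ z → + (z C suc k) * X) (ℕP.+-identityʳ (suc i)) ⟩
  + (suc i C suc k) * X
    ≡⟨ cong (λ z → + z * X) (sym (nCk+nC[k+1]≡[n+1]C[k+1] i k)) ⟩
  + (i C k ℕ.+ i C suc k) * X
    ≡⟨ cong (_* X) (ℤP.pos-+ (i C k) (i C suc k)) ⟩
  (+ (i C k) + + (i C suc k)) * X
    ≡⟨ distribute (+ (i C k)) (+ (i C suc k)) X ⟩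
  + (i C suc k) * X + X * + (i C k)
    ≡⟨ cong₂ (λ z w → + (z C suc k) * X + + (w C suc k) * + (i C k))
         (sym (ℕP.+-identityʳ i)) (ℕP.+-comm 1 j) ⟩
  T i (suc j) 0 (suc k) + T j (suc i) 1 (suc k) ∎
  where
  X = + (suc j C suc k)
  distribute : ∀ a b x → (a + b) * x ≡ b * x + x * a
  distribute = solve-∀

T-recurrence₁ : ∀ i j d k → T (suc i) (suc j) (suc d) k ≡ T i (suc j) (suc d) k + Sh (T (suc i) j d) k
T-recurrence₁ i j d zero =
  trans (ℤP.*-zeroʳ (+ ((suc i ℕ.+ suc d) C 0)))
        (sym (trans (ℤP.+-identityʳ _) (ℤP.*-zeroʳ (+ ((i ℕ.+ suc d) C 0)))))
T-recurrence₁ i j d (suc k) = begin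
  + (suc M C suc k) * X
    ≡⟨ cong (λ z → + z * X) (sym (nCk+nC[k+1]≡[n+1]C[k+1] M k)) ⟩
  + (M C k ℕ.+ M C suc k) * X
    ≡⟨ cong (_* X) (ℤP.pos-+ (M C k) (M C suc k)) ⟩
  (+ (M C k) + + (M C suc k)) * X
    ≡⟨ distribute (+ (M C k)) (+ (M C suc k)) X ⟩
  + (M C suc k) * X + + (M C k) * X
    ≡⟨ cong (λ z → + (M C suc k) * X + + (z C k) * X) (ℕP.+-suc i d) ⟩
  T i (suc j) (suc d) (suc k) + Sh (T (suc i) j d) (suc k) ∎
  where
  M = i ℕ.+ suc d
  X = Sh^ d (λ t → + ((j ∸ d) C t)) k
  distribute : ∀ a b x → (a + b) * x ≡ b * x + a * x
  distribute = solve-∀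

∇^-step : ∀ N {f g h G H F : Seq} → ∇ f ≗ (λ m → g m + h m) →
  ∇^ N g ≗ G → ∇^ N h ≗ H → (∀ k → F k ≡ G k + H k) → ∇^ (suc N) f ≗ F
∇^-step N {f} {g} {h} {G} {H} {F} split ∇g ∇h recurrence k = begin
  ∇^ (suc N) f k                    ≡⟨ ∇^-suc N f k ⟩
  ∇^ N (∇ f) k                      ≡⟨ ∇^-cong N split k ⟩
  ∇^ N (λ m → g m + h m) k          ≡⟨ ∇^-+ N g h k ⟩
  ∇^ N g k + ∇^ N h k               ≡⟨ cong₂ _+_ (∇g k) (∇h k) ⟩
  G k + H k                         ≡⟨ sym (recurrence k) ⟩
  F k                               ∎

∇^-P : ∀ N i j d → i ℕ.+ j ≡ N → d ≤ j → ∇^ (suc N) (P i j d) ≗ T i j d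
∇^-P N zero j d refl d≤j k = begin
  ∇^ (suc j) (P 0 j d) k       ≡⟨ ∇^-cong (suc j) (λ m → ℤP.*-identityˡ (Sh^ d (c j) m)) k ⟩
  ∇^ (suc j) (Sh^ d (c j)) k   ≡⟨ ∇^-Sh^ (suc j) d (c j) k ⟩
  Sh^ d (∇^ (suc j) (c j)) k   ≡⟨ Sh^-cong d (∇^-c j) k ⟩
  Sh^ d δ k                    ≡⟨ T-base j d k ⟩
  T 0 j d k                    ∎
∇^-P N (suc i) zero zero refl z≤n k = begin
  ∇^ (suc (suc i ℕ.+ 0)) (P (suc i) 0 0) k
    ≡⟨ cong (λ r → ∇^ (suc r) (P (suc i) 0 0) k) (ℕP.+-identityʳ (suc i)) ⟩
  ∇^ (suc (suc i)) (P (suc i) 0 0) k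
    ≡⟨ ∇^-cong (suc (suc i)) (λ m → ℤP.*-identityʳ (c (suc i) m)) k ⟩
  ∇^ (suc (suc i)) (c (suc i)) k   ≡⟨ ∇^-c (suc i) k ⟩
  δ k                              ≡⟨ δ-as-T k ⟩
  T (suc i) 0 0 k                  ∎
  where
  δ-as-T : ∀ k → δ k ≡ T (suc i) 0 0 k
  δ-as-T zero    = refl
  δ-as-T (suc k) = sym (ℤP.*-zeroʳ (+ ((suc i ℕ.+ 0) C suc k)))
∇^-P (suc N) (suc i) (suc j) zero i+j≡N _ =
  ∇^-step (suc N) (P-recurrence₀ i j)
    (∇^-P N i (suc j) 0 i+1+j≡N z≤n)
    (∇^-P N j (suc i) 1 j+1+i≡N (s≤s z≤n))
    (T-recurrence₀ i j)
  where
  i+1+j≡N : i ℕ.+ suc j ≡ N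
  i+1+j≡N = ℕP.suc-injective i+j≡N
  j+1+i≡N : j ℕ.+ suc i ≡ N
  j+1+i≡N = trans (ℕP.+-suc j i) (trans (cong suc (ℕP.+-comm j i)) (trans (sym (ℕP.+-suc i j)) i+1+j≡N))
∇^-P (suc N) (suc i) (suc j) (suc d) i+j≡N (s≤s d≤j) =
  ∇^-step (suc N) (P-recurrence₁ i j d)
    (∇^-P N i (suc j) (suc d) i+1+j≡N (s≤s d≤j))
    (λ k → trans (∇^-Sh^ (suc N) 1 (P (suc i) j d) k) (Sh^-cong 1 (∇^-P N (suc i) j d i+1+j≡N′ d≤j) k))
    (T-recurrence₁ i j d)
  where
  i+1+j≡N : i ℕ.+ suc j ≡ N
  i+1+j≡N = ℕP.suc-injective i+j≡N
  i+1+j≡N′ : suc i ℕ.+ j ≡ N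
  i+1+j≡N′ = trans (sym (ℕP.+-suc i j)) i+1+j≡N

ev : Poly → ℤ → ℤ
ev []      x = + 0
ev (a ∷ P) x = a + x * ev P x

ev-addP : ∀ P Q x → ev (addP P Q) x ≡ ev P x + ev Q x
ev-addP []      Q       x = sym (ℤP.+-identityˡ (ev Q x))
ev-addP (a ∷ P) []      x = sym (ℤP.+-identityʳ _)
ev-addP (a ∷ P) (b ∷ Q) x rewrite ev-addP P Q x = regroup a b x (ev P x) (ev Q x)
  where
  regroup : ∀ a b x u v → a + b + x * (u + v) ≡ a + x * u + (b + x * v)
  regroup = solve-∀

ev-scaleP : ∀ c P x → ev (scaleP c P) x ≡ c * ev P x
ev-scaleP c []      x = sym (ℤP.*-zeroʳ c)
ev-scaleP c (a ∷ P) x rewrite ev-scaleP c P x = factor c a x (ev P x)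
  where
  factor : ∀ c a x u → c * a + x * (c * u) ≡ c * (a + x * u)
  factor = solve-∀

ev-mulP : ∀ P Q x → ev (mulP P Q) x ≡ ev P x * ev Q x
ev-mulP []      Q x = refl
ev-mulP (a ∷ P) Q x = begin
  ev (addP (scaleP a Q) (+ 0 ∷ mulP P Q)) x          ≡⟨ ev-addP (scaleP a Q) (+ 0 ∷ mulP P Q) x ⟩
  ev (scaleP a Q) x + (+ 0 + x * ev (mulP P Q) x)   ≡⟨ cong₂ (λ u v → u + (+ 0 + x * v)) (ev-scaleP a Q x) (ev-mulP P Q x) ⟩
  a * ev Q x + (+ 0 + x * (ev P x * ev Q x))        ≡⟨ regroup a x (ev P x) (ev Q x) ⟩
  (a + x * ev P x) * ev Q x                         ∎
  where
  regroup : ∀ a x u v → a * v + (+ 0 + x * (u * v)) ≡ (a + x * u) * v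
  regroup = solve-∀

ev-prodP : ∀ N (g : ℕ → ℕ) (h : ℕ → Poly) x →
  ev (prodP (map h (applyUpTo g N))) x ≡ ∏ N (λ i → ev (h (g i)) x)
ev-prodP zero    g h x = cong (λ s → + 1 + s) (ℤP.*-zeroʳ x)
ev-prodP (suc N) g h x =
  trans (ev-mulP (h (g 0)) _ x) (cong (ev (h (g 0)) x *_) (ev-prodP N (g ∘ suc) h x))

-- Length bounds (length P ≤ N means deg P < N).
addP-length : ∀ {N} P Q → length P ≤ N → length Q ≤ N → length (addP P Q) ≤ N
addP-length []      Q       _         lq        = lq
addP-length (a ∷ P) []      lp        _         = lp
addP-length (a ∷ P) (b ∷ Q) (s≤s lp) (s≤s lq) = s≤s (addP-length P Q lp lq)

mulP-length : ∀ {N M} P Q → length P ≤ N → length Q ≤ suc M → length (mulP P Q) ≤ N ℕ.+ M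
mulP-length []      Q _ _ = z≤n
mulP-length {suc N} {M} (a ∷ P) Q (s≤s lp) lq =
  addP-length (scaleP a Q) (+ 0 ∷ mulP P Q) scaled (s≤s (mulP-length P Q lp lq))
  where
  scaled : length (scaleP a Q) ≤ suc (N ℕ.+ M)
  scaled = ℕP.≤-trans (ℕP.≤-reflexive (length-map (a *_) Q)) (ℕP.≤-trans lq (s≤s (ℕP.m≤n+m M N)))

prodP-length : ∀ (h : ℕ → Poly) (xs : List ℕ) → (∀ i → length (h i) ≤ 2) →
  length (prodP (map h xs)) ≤ suc (length xs)
prodP-length h []       _  = ℕP.≤-refl
prodP-length h (x ∷ xs) lh = mulP-length (h x) (prodP (map h xs)) (lh x) (prodP-length h xs lh)

UinvMono-length : ∀ n p → p ≤ n → length (UinvMono n p) ≤ suc n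
UinvMono-length n p p≤n = ℕP.≤-trans
  (mulP-length (fallingP p) (risingP1 (n ∸ p))
     (factors (λ i → (- (+ i)) ∷ + 1 ∷ []) p (λ _ → ℕP.≤-refl))
     (factors (λ i → (+ suc i) ∷ + 1 ∷ []) (n ∸ p) (λ _ → ℕP.≤-refl)))
  (s≤s (ℕP.≤-reflexive (ℕP.m+[n∸m]≡n p≤n)))
  where
  factors : ∀ (h : ℕ → Poly) k → (∀ i → length (h i) ≤ 2) → length (prodP (map h (upTo k))) ≤ suc k
  factors h k linear = ℕP.≤-trans (prodP-length h (upTo k) linear)
                                  (s≤s (ℕP.≤-reflexive (length-upTo k)))

coeff-ev : ∀ P N m → length P ≤ N → ∑ N (λ q → coeff P q * + (m ℕ.^ q)) ≡ ev P (+ m)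
coeff-ev []      N       m _         = ∑-zero N _ (λ _ → refl)
coeff-ev (a ∷ P) (suc N) m (s≤s len) = cong₂ _+_ (ℤP.*-identityʳ a) (begin
  ∑ N (λ q → coeff P q * + (m ℕ.* m ℕ.^ q))    ≡⟨ ∑-cong N (λ q _ → pull-out q) ⟩
  ∑ N (λ q → + m * (coeff P q * + (m ℕ.^ q)))  ≡⟨ ∑-*ˡ N (+ m) _ ⟩
  + m * ∑ N (λ q → coeff P q * + (m ℕ.^ q))    ≡⟨ cong (+ m *_) (coeff-ev P N m len) ⟩
  + m * ev P (+ m)                             ∎)
  where
  swap : ∀ a b c → a * (b * c) ≡ b * (a * c)
  swap = solve-∀
  pull-out : ∀ q → coeff P q * + (m ℕ.* m ℕ.^ q) ≡ + m * (coeff P q * + (m ℕ.^ q))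
  pull-out q = trans (cong (coeff P q *_) (ℤP.pos-* m (m ℕ.^ q))) (swap (coeff P q) (+ m) (+ (m ℕ.^ q)))

binomial-factorials : ∀ a b → ((a ℕ.+ b) C a) ℕ.* (a ! ℕ.* b !) ≡ (a ℕ.+ b) !
binomial-factorials a b = begin
  ((a ℕ.+ b) C a) ℕ.* (a ! ℕ.* b !)
    ≡⟨ cong (λ z → ((a ℕ.+ b) C a) ℕ.* (a ! ℕ.* z !)) (sym (ℕP.m+n∸m≡n a b)) ⟩
  ((a ℕ.+ b) C a) ℕ.* (a ! ℕ.* (a ℕ.+ b ∸ a) !)
    ≡⟨ cong (ℕ._* (a ! ℕ.* (a ℕ.+ b ∸ a) !)) (nCk≡n!/k![n-k]! a≤a+b) ⟩
  ((a ℕ.+ b) ! / (a ! ℕ.* (a ℕ.+ b ∸ a) !)) ℕ.* (a ! ℕ.* (a ℕ.+ b ∸ a) !)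
    ≡⟨ m/n*n≡m (k![n∸k]!∣n! a≤a+b) ⟩
  (a ℕ.+ b) ! ∎
  where
  a≤a+b = ℕP.m≤m+n a b
  instance _ = a ℕP.!* (a ℕ.+ b ∸ a) !≢0

ev-fallingP : ∀ p x → ev (fallingP p) x ≡ ∏ p (λ i → x - + i)
ev-fallingP p x = trans (ev-prodP p id _ x) (∏-cong p (λ i → linear x (+ i)))
  where
  linear : ∀ x y → - y + x * (+ 1 + x * + 0) ≡ x - y
  linear = solve-∀

ev-risingP1 : ∀ k x → ev (risingP1 k) x ≡ ∏ k (λ i → + suc i + x)
ev-risingP1 k x = trans (ev-prodP k id _ x) (∏-cong k (λ i → linear x (+ suc i)))
  where
  linear : ∀ x y → y + x * (+ 1 + x * + 0) ≡ y + x
  linear = solve-∀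

falling-shift : ∀ m i → + suc m - + suc i ≡ + m - + i
falling-shift m i rewrite ℤP.pos-+ 1 m | ℤP.pos-+ 1 i = cancel (+ m) (+ i)
  where
  cancel : ∀ x y → + 1 + x - (+ 1 + y) ≡ x - y
  cancel = solve-∀

rising-shift : ∀ m i → + suc (suc i) + + m ≡ + suc i + + suc m
rising-shift m i = cong +_ (sym (ℕP.+-suc (suc i) m))

falling-vanishes : ∀ p m → m < p → ∏ p (λ i → + m - + i) ≡ + 0
falling-vanishes (suc p) zero    _         = refl
falling-vanishes (suc p) (suc m) (s≤s m<p) = begin
  (+ suc m - + 0) * ∏ p (λ i → + suc m - + suc i) ≡⟨ cong ((+ suc m - + 0) *_) (∏-cong p (falling-shift m)) ⟩
  (+ suc m - + 0) * ∏ p (λ i → + m - + i)         ≡⟨ cong ((+ suc m - + 0) *_) (falling-vanishes p m m<p) ⟩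
  (+ suc m - + 0) * + 0                           ≡⟨ ℤP.*-zeroʳ (+ suc m - + 0) ⟩
  + 0                                             ∎

falling-factorial : ∀ p u → ∏ p (λ i → + (p ℕ.+ u) - + i) * + (u !) ≡ + ((p ℕ.+ u) !)
falling-factorial zero    u = ℤP.*-identityˡ _
falling-factorial (suc p) u = begin
  (x - + 0) * ∏ p (λ i → x - + suc i) * + (u !)
    ≡⟨ cong₂ (λ a b → a * b * + (u !)) (ℤP.+-identityʳ x) (∏-cong p (falling-shift (p ℕ.+ u))) ⟩
  x * F * + (u !)               ≡⟨ ℤP.*-assoc x F (+ (u !)) ⟩
  x * (F * + (u !))             ≡⟨ cong (x *_) (falling-factorial p u) ⟩
  x * + ((p ℕ.+ u) !)           ≡⟨ sym (ℤP.pos-* (suc (p ℕ.+ u)) ((p ℕ.+ u) !)) ⟩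
  + ((suc p ℕ.+ u) !)           ∎
  where
  x = + (suc p ℕ.+ u)
  F = ∏ p (λ i → + (p ℕ.+ u) - + i)

rising-factorial : ∀ L m → + (m !) * ∏ L (λ i → + suc i + + m) ≡ + ((L ℕ.+ m) !)
rising-factorial zero    m = ℤP.*-identityʳ _
rising-factorial (suc L) m = begin
  + (m !) * (+ suc m * ∏ L (λ i → + suc (suc i) + + m))
    ≡⟨ cong (λ z → + (m !) * (+ suc m * z)) (∏-cong L (rising-shift m)) ⟩
  + (m !) * (+ suc m * R)     ≡⟨ regroup (+ (m !)) (+ suc m) R ⟩
  (+ suc m * + (m !)) * R     ≡⟨ cong (_* R) (sym (ℤP.pos-* (suc m) (m !))) ⟩
  + (suc m !) * R             ≡⟨ rising-factorial L (suc m) ⟩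
  + ((L ℕ.+ suc m) !)         ≡⟨ cong (λ z → + (z !)) (ℕP.+-suc L m) ⟩
  + ((suc L ℕ.+ m) !)         ∎
  where
  R = ∏ L (λ i → + suc i + + suc m)
  regroup : ∀ a b c → a * (b * c) ≡ (b * a) * c
  regroup = solve-∀

ev-falling-rising : ∀ n p x → ev (UinvMono n p) x ≡ ∏ p (λ i → x - + i) * ∏ (n ∸ p) (λ i → + suc i + x)
ev-falling-rising n p x = trans (ev-mulP (fallingP p) (risingP1 (n ∸ p)) x)
                                (cong₂ _*_ (ev-fallingP p x) (ev-risingP1 (n ∸ p) x))

ev-UinvMono : ∀ n p → p ≤ n → ∀ m → ev (UinvMono n p) (+ m) ≡ + (n !) * Sh^ p (c n) m
ev-UinvMono n p p≤n m with below-or-shifted p m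
... | inj₁ m<p = begin
  ev (UinvMono n p) (+ m)   ≡⟨ ev-falling-rising n p (+ m) ⟩
  F * R                     ≡⟨ cong (_* R) (falling-vanishes p m m<p) ⟩
  + 0 * R                   ≡⟨ ℤP.*-zeroˡ R ⟩
  + 0                       ≡⟨ sym (ℤP.*-zeroʳ (+ (n !))) ⟩
  + (n !) * + 0             ≡⟨ cong (+ (n !) *_) (sym (Sh^-below p (c n) m m<p)) ⟩
  + (n !) * Sh^ p (c n) m   ∎
  where
  F = ∏ p (λ i → + m - + i)
  R = ∏ (n ∸ p) (λ i → + suc i + + m)
... | inj₂ (u , refl) = begin
  ev (UinvMono n p) (+ (p ℕ.+ u))  ≡⟨ ev-falling-rising n p (+ (p ℕ.+ u)) ⟩
  F * R                            ≡⟨ ℤP.*-cancelʳ-≡ _ _ (+ (u !)) {{u ℕP.!≢0}} multiplied ⟩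
  + (n !) * c n u                  ≡⟨ cong (+ (n !) *_) (sym (Sh^-at p (c n) u)) ⟩
  + (n !) * Sh^ p (c n) (p ℕ.+ u)  ∎
  where
  F = ∏ p (λ i → + (p ℕ.+ u) - + i)
  R = ∏ (n ∸ p) (λ i → + suc i + + (p ℕ.+ u))
  swap₂₃ : ∀ a b c → a * b * c ≡ a * c * b
  swap₂₃ = solve-∀
  n+u≡ : n ∸ p ℕ.+ (p ℕ.+ u) ≡ n ℕ.+ u
  n+u≡ = trans (sym (ℕP.+-assoc (n ∸ p) p u)) (cong (ℕ._+ u) (ℕP.m∸n+n≡m p≤n))
  -- (p+u)_p [p+u+1]_{n-p} · u! = (n+u)! = n! C(n+u,n) u!
  multiplied : F * R * + (u !) ≡ + (n !) * c n u * + (u !)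
  multiplied = begin
    F * R * + (u !)                    ≡⟨ swap₂₃ F R (+ (u !)) ⟩
    F * + (u !) * R                    ≡⟨ cong (_* R) (falling-factorial p u) ⟩
    + ((p ℕ.+ u) !) * R                ≡⟨ rising-factorial (n ∸ p) (p ℕ.+ u) ⟩
    + ((n ∸ p ℕ.+ (p ℕ.+ u)) !)        ≡⟨ cong (λ z → + (z !)) n+u≡ ⟩
    + ((n ℕ.+ u) !)                    ≡⟨ cong +_ (sym (binomial-factorials n u)) ⟩
    + (((n ℕ.+ u) C n) ℕ.* (n ! ℕ.* u !))
      ≡⟨ cong +_ (regroupℕ ((n ℕ.+ u) C n) (n !) (u !)) ⟩
    + (n ! ℕ.* ((n ℕ.+ u) C n) ℕ.* u !)
      ≡⟨ trans (ℤP.pos-* (n ! ℕ.* ((n ℕ.+ u) C n)) (u !)) (cong (_* + (u !)) (ℤP.pos-* (n !) _)) ⟩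
    + (n !) * + ((n ℕ.+ u) C n) * + (u !)
      ≡⟨ cong (λ z → + (n !) * + (z C n) * + (u !)) (ℕP.+-comm n u) ⟩
    + (n !) * c n u * + (u !)          ∎
    where
    regroupℕ : ∀ a b c → a ℕ.* (b ℕ.* c) ≡ b ℕ.* a ℕ.* c
    regroupℕ = ℕ-Solver.solve-∀

-- F_n Q = (1 - x)^{2n+1} Σ_m Q(m) C(m+n,n) x^m  for deg Q ≤ n: the coefficients
-- of F_n Q are the (2n+1)-fold differences of m ↦ Q(m) c_n(m).
FCoeff-difference : ∀ n Q → length Q ≤ suc n → ∀ k →
  FCoeff n Q k ≡ ∇^ (suc (2 ℕ.* n)) (λ m → ev Q (+ m) * c n m) k
FCoeff-difference n Q deg k = begin
  FCoeff n Q k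
    ≡⟨ foldr-applyUpTo (suc n) id (λ q → coeff Q q * FMonoCoeff n q k) ⟩
  ∑ (suc n) (λ q → coeff Q q * FMonoCoeff n q k)
    ≡⟨ ∑-cong (suc n) (λ q _ → cong (coeff Q q *_) (foldr-applyUpTo (suc k) id (X q))) ⟩
  ∑ (suc n) (λ q → coeff Q q * ∑ (suc k) (X q))
    ≡⟨ ∑-cong (suc n) (λ q _ → sym (∑-*ˡ (suc k) (coeff Q q) (X q))) ⟩
  ∑ (suc n) (λ q → ∑ (suc k) (λ j → coeff Q q * X q j))
    ≡⟨ ∑-swap (suc n) (suc k) (λ q j → coeff Q q * X q j) ⟩
  ∑ (suc k) (λ j → ∑ (suc n) (λ q → coeff Q q * X q j))
    ≡⟨ ∑-cong (suc k) (λ j _ → evaluate j) ⟩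
  ∑ (suc k) (λ j → sgn j * + (r C j) * a (k ∸ j))
    ≡⟨ sym (∇^-expansion r a k) ⟩
  ∇^ r a k ∎
  where
  r = suc (2 ℕ.* n)
  a : Seq
  a m = ev Q (+ m) * c n m
  X : ℕ → ℕ → ℤ
  X q j = sgn j * + (((r C j) ℕ.* ((k ∸ j) ℕ.^ q)) ℕ.* ((k ∸ j ℕ.+ n) C n))
  -- the inner sum over q evaluates Q at k - j
  evaluate : ∀ j → ∑ (suc n) (λ q → coeff Q q * X q j) ≡ sgn j * + (r C j) * a (k ∸ j)
  evaluate j = begin
    ∑ (suc n) (λ q → coeff Q q * X q j)               ≡⟨ ∑-cong (suc n) (λ q _ → factor-out q) ⟩
    ∑ (suc n) (λ q → K * (coeff Q q * + (w ℕ.^ q)))   ≡⟨ ∑-*ˡ (suc n) K (λ q → coeff Q q * + (w ℕ.^ q)) ⟩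
    K * ∑ (suc n) (λ q → coeff Q q * + (w ℕ.^ q))     ≡⟨ cong (K *_) (coeff-ev Q (suc n) w deg) ⟩
    K * ev Q (+ w)                                    ≡⟨ regroup (sgn j) (+ A) (+ B) (ev Q (+ w)) ⟩
    sgn j * + A * a w                                 ∎
    where
    w = k ∸ j
    A = r C j
    B = (w ℕ.+ n) C n
    K = sgn j * + A * + B
    regroup : ∀ s x z e → (s * x * z) * e ≡ s * x * (e * z)
    regroup = solve-∀
    rearrange : ∀ u s x y z → u * (s * (x * y * z)) ≡ (s * x * z) * (u * y)
    rearrange = solve-∀
    factor-out : ∀ q → coeff Q q * X q j ≡ K * (coeff Q q * + (w ℕ.^ q))
    factor-out q = trans
      (cong (λ t → coeff Q q * (sgn j * t))
        (trans (ℤP.pos-* (A ℕ.* (w ℕ.^ q)) B) (cong (_* + B) (ℤP.pos-* A (w ℕ.^ q)))))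
      (rearrange (coeff Q q) (sgn j) (+ A) (+ (w ℕ.^ q)) (+ B))

SMonoCoeff-difference : ∀ n p → p ≤ n → ∀ k → SMonoCoeff n p k ≡ + (n !) * T n n p k
SMonoCoeff-difference n p p≤n k = begin
  SMonoCoeff n p k
    ≡⟨ FCoeff-difference n (UinvMono n p) (UinvMono-length n p p≤n) k ⟩
  ∇^ r (λ m → ev (UinvMono n p) (+ m) * c n m) k
    ≡⟨ ∇^-cong r (λ m → trans (cong (_* c n m) (ev-UinvMono n p p≤n m)) (regroup (+ (n !)) (Sh^ p (c n) m) (c n m))) k ⟩
  ∇^ r (λ m → + (n !) * P n n p m) k
    ≡⟨ ∇^-* r (+ (n !)) (P n n p) k ⟩
  + (n !) * ∇^ r (P n n p) k
    ≡⟨ cong (+ (n !) *_) (∇^-P (2 ℕ.* n) n n p n+n≡2n p≤n k) ⟩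
  + (n !) * T n n p k ∎
  where
  r = suc (2 ℕ.* n)
  regroup : ∀ a s b → a * s * b ≡ a * (b * s)
  regroup = solve-∀
  n+n≡2n : n ℕ.+ n ≡ 2 ℕ.* n
  n+n≡2n = cong (n ℕ.+_) (sym (ℕP.+-identityʳ n))

-- The constant (n+p)!(n-p)!/n! of the theorem is the integer C(n+p,n) · p! · (n-p)!.
normalising-constant : ∀ n p →
  _/_ ((n ℕ.+ p) ! ℕ.* (n ∸ p) !) (n !) {{n ℕP.!≢0}} ≡ (((n ℕ.+ p) C n) ℕ.* p !) ℕ.* (n ∸ p) !
normalising-constant n p = begin
  _/_ ((n ℕ.+ p) ! ℕ.* (n ∸ p) !) (n !) {{n ℕP.!≢0}}
    ≡⟨ cong (λ z → _/_ (z ℕ.* (n ∸ p) !) (n !) {{n ℕP.!≢0}}) (sym (binomial-factorials n p)) ⟩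
  _/_ (((n ℕ.+ p) C n) ℕ.* (n ! ℕ.* p !) ℕ.* (n ∸ p) !) (n !) {{n ℕP.!≢0}}
    ≡⟨ cong (λ z → _/_ z (n !) {{n ℕP.!≢0}}) (regroup ((n ℕ.+ p) C n) (n !) (p !) ((n ∸ p) !)) ⟩
  _/_ ((((n ℕ.+ p) C n) ℕ.* p !) ℕ.* (n ∸ p) ! ℕ.* n !) (n !) {{n ℕP.!≢0}}
    ≡⟨ m*n/n≡m _ (n !) {{n ℕP.!≢0}} ⟩
  (((n ℕ.+ p) C n) ℕ.* p !) ℕ.* (n ∸ p) ! ∎
  where
  regroup : ∀ c a b l → c ℕ.* (a ℕ.* b) ℕ.* l ≡ c ℕ.* b ℕ.* l ℕ.* a
  regroup = ℕ-Solver.solve-∀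

-- Multiplied by (p+t)! (p+s)! t! s!, both sides become n! (n+p)! (t+s)!,
-- by five instances of binomial-factorials.
factorial-identity : ∀ p t s → let n = p ℕ.+ (t ℕ.+ s) in
  n ! ℕ.* (((n ℕ.+ p) C (p ℕ.+ t)) ℕ.* ((t ℕ.+ s) C t))
    ≡ (((n ℕ.+ p) C n) ℕ.* p ! ℕ.* (t ℕ.+ s) !) ℕ.* ((n C t) ℕ.* (n C s))
factorial-identity p t s = ℕP.*-cancelʳ-≡ _ _ X {{X≢0}} (trans lhs·X (sym rhs·X))
  where
  N = p ℕ.+ (t ℕ.+ s)
  A = (p ℕ.+ t) !
  B = (p ℕ.+ s) !
  L = (t ℕ.+ s) !
  C₀ = (N ℕ.+ p) C N
  X = (A ℕ.* B) ℕ.* (t ! ℕ.* s !)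
  X≢0 : NonZero X
  X≢0 = ℕP.m*n≢0 (A ℕ.* B) (t ! ℕ.* s !)
          {{ℕP.m*n≢0 A B {{(p ℕ.+ t) ℕP.!≢0}} {{(p ℕ.+ s) ℕP.!≢0}}}}
          {{ℕP.m*n≢0 (t !) (s !) {{t ℕP.!≢0}} {{s ℕP.!≢0}}}}
  sum-p+t : ∀ p t s → (p ℕ.+ t) ℕ.+ (p ℕ.+ s) ≡ (p ℕ.+ (t ℕ.+ s)) ℕ.+ p
  sum-p+t = ℕ-Solver.solve-∀
  sum-t : ∀ p t s → t ℕ.+ (p ℕ.+ s) ≡ p ℕ.+ (t ℕ.+ s)
  sum-t = ℕ-Solver.solve-∀
  sum-s : ∀ p t s → s ℕ.+ (p ℕ.+ t) ≡ p ℕ.+ (t ℕ.+ s)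
  sum-s = ℕ-Solver.solve-∀
  choose-p+t : ((N ℕ.+ p) C (p ℕ.+ t)) ℕ.* (A ℕ.* B) ≡ (N ℕ.+ p) !
  choose-p+t = subst (λ z → (z C (p ℕ.+ t)) ℕ.* (A ℕ.* B) ≡ z !) (sum-p+t p t s) (binomial-factorials (p ℕ.+ t) (p ℕ.+ s))
  choose-t : ((t ℕ.+ s) C t) ℕ.* (t ! ℕ.* s !) ≡ L
  choose-t = binomial-factorials t s
  choose-N : C₀ ℕ.* (N ! ℕ.* p !) ≡ (N ℕ.+ p) !
  choose-N = binomial-factorials N p
  choose-t-in-N : (N C t) ℕ.* (t ! ℕ.* B) ≡ N !
  choose-t-in-N = subst (λ z → (z C t) ℕ.* (t ! ℕ.* B) ≡ z !) (sum-t p t s) (binomial-factorials t (p ℕ.+ s))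
  choose-s-in-N : (N C s) ℕ.* (s ! ℕ.* A) ≡ N !
  choose-s-in-N = subst (λ z → (z C s) ℕ.* (s ! ℕ.* A) ≡ z !) (sum-s p t s) (binomial-factorials s (p ℕ.+ t))
  lhs·X : N ! ℕ.* (((N ℕ.+ p) C (p ℕ.+ t)) ℕ.* ((t ℕ.+ s) C t)) ℕ.* X ≡ N ! ℕ.* (N ℕ.+ p) ! ℕ.* L
  lhs·X = trans (regroup (N !) ((N ℕ.+ p) C (p ℕ.+ t)) ((t ℕ.+ s) C t) A B (t !) (s !))
                (cong₂ (λ u v → N ! ℕ.* u ℕ.* v) choose-p+t choose-t)
    where
    regroup : ∀ n c₁ c₂ a b t s → n ℕ.* (c₁ ℕ.* c₂) ℕ.* ((a ℕ.* b) ℕ.* (t ℕ.* s))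
                                ≡ n ℕ.* (c₁ ℕ.* (a ℕ.* b)) ℕ.* (c₂ ℕ.* (t ℕ.* s))
    regroup = ℕ-Solver.solve-∀
  rhs·X : (C₀ ℕ.* p ! ℕ.* L) ℕ.* ((N C t) ℕ.* (N C s)) ℕ.* X ≡ N ! ℕ.* (N ℕ.+ p) ! ℕ.* L
  rhs·X = begin
    (C₀ ℕ.* p ! ℕ.* L) ℕ.* ((N C t) ℕ.* (N C s)) ℕ.* X
      ≡⟨ regroup C₀ (p !) L (N C t) (N C s) A B (t !) (s !) ⟩
    C₀ ℕ.* (((N C t) ℕ.* (t ! ℕ.* B)) ℕ.* p !) ℕ.* L ℕ.* ((N C s) ℕ.* (s ! ℕ.* A))
      ≡⟨ cong₂ (λ u v → C₀ ℕ.* (u ℕ.* p !) ℕ.* L ℕ.* v) choose-t-in-N choose-s-in-N ⟩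
    C₀ ℕ.* (N ! ℕ.* p !) ℕ.* L ℕ.* N !
      ≡⟨ cong (λ u → u ℕ.* L ℕ.* N !) choose-N ⟩
    (N ℕ.+ p) ! ℕ.* L ℕ.* N !
      ≡⟨ rotate ((N ℕ.+ p) !) L (N !) ⟩
    N ! ℕ.* (N ℕ.+ p) ! ℕ.* L ∎
    where
    regroup : ∀ c₀ q l u v a b t s → (c₀ ℕ.* q ℕ.* l) ℕ.* (u ℕ.* v) ℕ.* ((a ℕ.* b) ℕ.* (t ℕ.* s))
                                   ≡ c₀ ℕ.* ((u ℕ.* (t ℕ.* b)) ℕ.* q) ℕ.* l ℕ.* (v ℕ.* (s ℕ.* a))
    regroup = ℕ-Solver.solve-∀
    rotate : ∀ a b c → a ℕ.* b ℕ.* c ≡ c ℕ.* a ℕ.* b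
    rotate = ℕ-Solver.solve-∀

coefficient-identity : ∀ n p t → p ≤ n → t ≤ n ∸ p →
  n ! ℕ.* (((n ℕ.+ p) C (p ℕ.+ t)) ℕ.* ((n ∸ p) C t))
    ≡ _/_ ((n ℕ.+ p) ! ℕ.* (n ∸ p) !) (n !) {{n ℕP.!≢0}}
        ℕ.* ((n C ((p ℕ.+ t) ∸ p)) ℕ.* (n C (n ∸ (p ℕ.+ t))))
coefficient-identity n p t p≤n t≤n-p = subst identity-for n-decomposition (decomposed (n ∸ p ∸ t))
  where
  identity-for : ℕ → Set
  identity-for n = n ! ℕ.* (((n ℕ.+ p) C (p ℕ.+ t)) ℕ.* ((n ∸ p) C t))
    ≡ _/_ ((n ℕ.+ p) ! ℕ.* (n ∸ p) !) (n !) {{n ℕP.!≢0}}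
        ℕ.* ((n C ((p ℕ.+ t) ∸ p)) ℕ.* (n C (n ∸ (p ℕ.+ t))))
  n-decomposition : p ℕ.+ (t ℕ.+ (n ∸ p ∸ t)) ≡ n
  n-decomposition = trans (cong (p ℕ.+_) (ℕP.m+[n∸m]≡n t≤n-p)) (ℕP.m+[n∸m]≡n p≤n)
  decomposed : ∀ s → identity-for (p ℕ.+ (t ℕ.+ s))
  decomposed s = begin
    N ! ℕ.* (((N ℕ.+ p) C (p ℕ.+ t)) ℕ.* ((N ∸ p) C t))
      ≡⟨ cong (λ z → N ! ℕ.* (((N ℕ.+ p) C (p ℕ.+ t)) ℕ.* (z C t))) N-p≡t+s ⟩
    N ! ℕ.* (((N ℕ.+ p) C (p ℕ.+ t)) ℕ.* ((t ℕ.+ s) C t))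
      ≡⟨ factorial-identity p t s ⟩
    (((N ℕ.+ p) C N) ℕ.* p ! ℕ.* (t ℕ.+ s) !) ℕ.* ((N C t) ℕ.* (N C s))
      ≡⟨ cong₂ (λ a b → (((N ℕ.+ p) C N) ℕ.* p ! ℕ.* a !) ℕ.* ((N C b) ℕ.* (N C s)))
           (sym N-p≡t+s) (sym (ℕP.m+n∸m≡n p t)) ⟩
    (((N ℕ.+ p) C N) ℕ.* p ! ℕ.* (N ∸ p) !) ℕ.* ((N C ((p ℕ.+ t) ∸ p)) ℕ.* (N C s))
      ≡⟨ cong₂ (λ a b → a ℕ.* ((N C ((p ℕ.+ t) ∸ p)) ℕ.* (N C b)))
           (sym (normalising-constant N p)) (sym N-[p+t]≡s) ⟩
    _/_ ((N ℕ.+ p) ! ℕ.* (N ∸ p) !) (N !) {{N ℕP.!≢0}}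
      ℕ.* ((N C ((p ℕ.+ t) ∸ p)) ℕ.* (N C (N ∸ (p ℕ.+ t)))) ∎
    where
    N = p ℕ.+ (t ℕ.+ s)
    N-p≡t+s : N ∸ p ≡ t ℕ.+ s
    N-p≡t+s = ℕP.m+n∸m≡n p (t ℕ.+ s)
    N-[p+t]≡s : N ∸ (p ℕ.+ t) ≡ s
    N-[p+t]≡s = trans (cong (_∸ (p ℕ.+ t)) (sym (ℕP.+-assoc p t s))) (ℕP.m+n∸m≡n (p ℕ.+ t) s)

coeff-addP : ∀ P Q k → coeff (addP P Q) k ≡ coeff P k + coeff Q k
coeff-addP []      Q       k       = sym (ℤP.+-identityˡ _)
coeff-addP (a ∷ P) []      k       = sym (ℤP.+-identityʳ _)
coeff-addP (a ∷ P) (b ∷ Q) zero    = refl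
coeff-addP (a ∷ P) (b ∷ Q) (suc k) = coeff-addP P Q k

coeff-scaleP : ∀ a P k → coeff (scaleP a P) k ≡ a * coeff P k
coeff-scaleP a []      k       = sym (ℤP.*-zeroʳ a)
coeff-scaleP a (b ∷ P) zero    = refl
coeff-scaleP a (b ∷ P) (suc k) = coeff-scaleP a P k

coeff-monoP-below : ∀ m k → k < m → coeff (monoP m) k ≡ + 0
coeff-monoP-below (suc m) zero    _         = refl
coeff-monoP-below (suc m) (suc k) (s≤s k<m) = coeff-monoP-below m k k<m

coeff-monoP-shift : ∀ d t s → coeff (monoP (d ℕ.+ t)) (d ℕ.+ s) ≡ coeff (monoP t) s
coeff-monoP-shift zero    t s = refl
coeff-monoP-shift (suc d) t s = coeff-monoP-shift d t s

∑-select-inside : ∀ L (f : ℕ → ℤ) s → s < L → ∑ L (λ t → f t * coeff (monoP t) s) ≡ f s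
∑-select-inside (suc L) f zero _ =
  trans (cong₂ _+_ (ℤP.*-identityʳ (f 0)) (∑-zero L _ (λ t → ℤP.*-zeroʳ (f (suc t))))) (ℤP.+-identityʳ (f 0))
∑-select-inside (suc L) f (suc s) (s≤s s<L) =
  trans (cong₂ _+_ (ℤP.*-zeroʳ (f 0)) (∑-select-inside L (f ∘ suc) s s<L)) (ℤP.+-identityˡ _)

∑-select-beyond : ∀ L (f : ℕ → ℤ) s → L ≤ s → ∑ L (λ t → f t * coeff (monoP t) s) ≡ + 0
∑-select-beyond zero    f s       _         = refl
∑-select-beyond (suc L) f (suc s) (s≤s L≤s) =
  cong₂ _+_ (ℤP.*-zeroʳ (f 0)) (∑-select-beyond L (f ∘ suc) s L≤s)

coeff-monomial-sum : ∀ p L (g : ℕ → ℕ) (f : ℕ → ℤ) k →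
  coeff (sumP (map (λ m → scaleP (f m) (monoP m)) (map (p ℕ.+_) (applyUpTo g L)))) k
    ≡ ∑ L (λ t → f (p ℕ.+ g t) * coeff (monoP (p ℕ.+ g t)) k)
coeff-monomial-sum p zero    g f k = refl
coeff-monomial-sum p (suc L) g f k = begin
  coeff (addP (scaleP (f (p ℕ.+ g 0)) (monoP (p ℕ.+ g 0))) rest) k
    ≡⟨ coeff-addP (scaleP (f (p ℕ.+ g 0)) (monoP (p ℕ.+ g 0))) rest k ⟩
  coeff (scaleP (f (p ℕ.+ g 0)) (monoP (p ℕ.+ g 0))) k + coeff rest k
    ≡⟨ cong₂ _+_ (coeff-scaleP (f (p ℕ.+ g 0)) (monoP (p ℕ.+ g 0)) k) (coeff-monomial-sum p L (g ∘ suc) f k) ⟩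
  ∑ (suc L) (λ t → f (p ℕ.+ g t) * coeff (monoP (p ℕ.+ g t)) k) ∎
  where
  rest = sumP (map (λ m → scaleP (f m) (monoP m)) (map (p ℕ.+_) (applyUpTo (g ∘ suc) L)))

leading-constant : ℕ → ℕ → ℕ
leading-constant n p = _/_ ((n ℕ.+ p) ! ℕ.* (n ∸ p) !) (n !) {{n ℕP.!≢0}}

weight : ℕ → ℕ → ℕ → ℕ
weight n p m = (n C (m ∸ p)) ℕ.* (n C (n ∸ m))

coeff-rhsP : ∀ n p k → coeff (rhsP n p) k
  ≡ + leading-constant n p * ∑ (suc (n ∸ p)) (λ t → + weight n p (p ℕ.+ t) * coeff (monoP (p ℕ.+ t)) k)
coeff-rhsP n p k =
  trans (coeff-scaleP (+ leading-constant n p) terms k)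
        (cong (+ leading-constant n p *_) (coeff-monomial-sum p (suc (n ∸ p)) id (λ m → + weight n p m) k))
  where
  terms = sumP (map (λ m → scaleP (+ weight n p m) (monoP m)) (map (p ℕ.+_) (upTo (suc (n ∸ p)))))

rhsP-below : ∀ n p k → k < p → coeff (rhsP n p) k ≡ + 0
rhsP-below n p k k<p = begin
  coeff (rhsP n p) k
    ≡⟨ coeff-rhsP n p k ⟩
  + leading-constant n p * ∑ (suc (n ∸ p)) (λ t → + weight n p (p ℕ.+ t) * coeff (monoP (p ℕ.+ t)) k)
    ≡⟨ cong (+ leading-constant n p *_) (∑-zero (suc (n ∸ p)) _ vanishes) ⟩
  + leading-constant n p * + 0
    ≡⟨ ℤP.*-zeroʳ (+ leading-constant n p) ⟩
  + 0 ∎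
  where
  vanishes : ∀ t → + weight n p (p ℕ.+ t) * coeff (monoP (p ℕ.+ t)) k ≡ + 0
  vanishes t = trans (cong (+ weight n p (p ℕ.+ t) *_)
                        (coeff-monoP-below (p ℕ.+ t) k (ℕP.<-≤-trans k<p (ℕP.m≤m+n p t))))
                     (ℤP.*-zeroʳ (+ weight n p (p ℕ.+ t)))

rhsP-shifted : ∀ n p t → coeff (rhsP n p) (p ℕ.+ t)
  ≡ + leading-constant n p * ∑ (suc (n ∸ p)) (λ u → + weight n p (p ℕ.+ u) * coeff (monoP u) t)
rhsP-shifted n p t = trans (coeff-rhsP n p (p ℕ.+ t))
  (cong (+ leading-constant n p *_)
    (∑-cong (suc (n ∸ p)) (λ u _ → cong (+ weight n p (p ℕ.+ u) *_) (coeff-monoP-shift p u t))))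

rhsP-inside : ∀ n p t → t ≤ n ∸ p → coeff (rhsP n p) (p ℕ.+ t) ≡ + (leading-constant n p ℕ.* weight n p (p ℕ.+ t))
rhsP-inside n p t t≤n-p = begin
  coeff (rhsP n p) (p ℕ.+ t)
    ≡⟨ rhsP-shifted n p t ⟩
  + leading-constant n p * ∑ (suc (n ∸ p)) (λ u → + weight n p (p ℕ.+ u) * coeff (monoP u) t)
    ≡⟨ cong (+ leading-constant n p *_) (∑-select-inside (suc (n ∸ p)) (λ u → + weight n p (p ℕ.+ u)) t (s≤s t≤n-p)) ⟩
  + leading-constant n p * + weight n p (p ℕ.+ t)
    ≡⟨ sym (ℤP.pos-* (leading-constant n p) (weight n p (p ℕ.+ t))) ⟩
  + (leading-constant n p ℕ.* weight n p (p ℕ.+ t)) ∎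

rhsP-beyond : ∀ n p t → n ∸ p < t → coeff (rhsP n p) (p ℕ.+ t) ≡ + 0
rhsP-beyond n p t n-p<t = begin
  coeff (rhsP n p) (p ℕ.+ t)
    ≡⟨ rhsP-shifted n p t ⟩
  + leading-constant n p * ∑ (suc (n ∸ p)) (λ u → + weight n p (p ℕ.+ u) * coeff (monoP u) t)
    ≡⟨ cong (+ leading-constant n p *_) (∑-select-beyond (suc (n ∸ p)) (λ u → + weight n p (p ℕ.+ u)) t n-p<t) ⟩
  + leading-constant n p * + 0
    ≡⟨ ℤP.*-zeroʳ (+ leading-constant n p) ⟩
  + 0 ∎

SMonoCoeff-below : ∀ n p → p ≤ n → ∀ k → k < p → SMonoCoeff n p k ≡ + 0
SMonoCoeff-below n p p≤n k k<p = begin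
  SMonoCoeff n p k                    ≡⟨ SMonoCoeff-difference n p p≤n k ⟩
  + (n !) * (B * Sh^ p binom k)       ≡⟨ cong (λ z → + (n !) * (B * z)) (Sh^-below p binom k k<p) ⟩
  + (n !) * (B * + 0)                 ≡⟨ cong (+ (n !) *_) (ℤP.*-zeroʳ B) ⟩
  + (n !) * + 0                       ≡⟨ ℤP.*-zeroʳ (+ (n !)) ⟩
  + 0                                 ∎
  where
  B = + ((n ℕ.+ p) C k)
  binom = λ t → + ((n ∸ p) C t)

SMonoCoeff-shifted : ∀ n p → p ≤ n → ∀ t →
  SMonoCoeff n p (p ℕ.+ t) ≡ + (n ! ℕ.* (((n ℕ.+ p) C (p ℕ.+ t)) ℕ.* ((n ∸ p) C t)))
SMonoCoeff-shifted n p p≤n t = begin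
  SMonoCoeff n p (p ℕ.+ t)
    ≡⟨ SMonoCoeff-difference n p p≤n (p ℕ.+ t) ⟩
  + (n !) * (+ B * Sh^ p (λ u → + ((n ∸ p) C u)) (p ℕ.+ t))
    ≡⟨ cong (λ z → + (n !) * (+ B * z)) (Sh^-at p _ t) ⟩
  + (n !) * (+ B * + ((n ∸ p) C t))
    ≡⟨ cong (+ (n !) *_) (sym (ℤP.pos-* B ((n ∸ p) C t))) ⟩
  + (n !) * + (B ℕ.* ((n ∸ p) C t))
    ≡⟨ sym (ℤP.pos-* (n !) _) ⟩
  + (n ! ℕ.* (B ℕ.* ((n ∸ p) C t))) ∎
  where
  B = (n ℕ.+ p) C (p ℕ.+ t)

SMonoCoeff-beyond : ∀ n p → p ≤ n → ∀ t → n ∸ p < t → SMonoCoeff n p (p ℕ.+ t) ≡ + 0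
SMonoCoeff-beyond n p p≤n t n-p<t = begin
  SMonoCoeff n p (p ℕ.+ t)                     ≡⟨ SMonoCoeff-shifted n p p≤n t ⟩
  + (n ! ℕ.* (B ℕ.* ((n ∸ p) C t)))            ≡⟨ cong (λ z → + (n ! ℕ.* (B ℕ.* z))) (k>n⇒nCk≡0 n-p<t) ⟩
  + (n ! ℕ.* (B ℕ.* 0))                        ≡⟨ cong (λ z → + (n ! ℕ.* z)) (ℕP.*-zeroʳ B) ⟩
  + (n ! ℕ.* 0)                                ≡⟨ cong +_ (ℕP.*-zeroʳ (n !)) ⟩
  + 0                                          ∎
  where
  B = (n ℕ.+ p) C (p ℕ.+ t)

theorem13 : (n p : ℕ) → p ≤ n → (k : ℕ) → SMonoCoeff n p k ≡ coeff (rhsP n p) k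
theorem13 n p p≤n k with below-or-shifted p k
... | inj₁ k<p = trans (SMonoCoeff-below n p p≤n k k<p) (sym (rhsP-below n p k k<p))
... | inj₂ (t , refl) with t ℕP.≤? n ∸ p
...   | yes t≤n-p = begin
  SMonoCoeff n p (p ℕ.+ t)                                 ≡⟨ SMonoCoeff-shifted n p p≤n t ⟩
  + (n ! ℕ.* (((n ℕ.+ p) C (p ℕ.+ t)) ℕ.* ((n ∸ p) C t)))  ≡⟨ cong +_ (coefficient-identity n p t p≤n t≤n-p) ⟩
  + (leading-constant n p ℕ.* weight n p (p ℕ.+ t))        ≡⟨ sym (rhsP-inside n p t t≤n-p) ⟩
  coeff (rhsP n p) (p ℕ.+ t)                               ∎
...   | no t≰n-p =
  trans (SMonoCoeff-beyond n p p≤n t (ℕP.≰⇒> t≰n-p)) (sym (rhsP-beyond n p t (ℕP.≰⇒> t≰n-p)))
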